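{- For every prime power $q$, the group $\mathrm{Aff}(q) \times C_2$ contains a $(2q(q-1), 2q-1, 2)$ sum set, where $C_2$ is the cyclic group of order $2$.
   Context: $\mathrm{Aff}(q)$ is the group, under composition, of all maps $GF(q)\to GF(q)$ of the form $x \mapsto ax + b$ with $a \in GF(q)^*$, $b \in GF(q)$; it has order $q(q-1)$. For a finite group $X$ of order $w$, $T\subseteq X$ with $|T|=k$ is a $(w,k,\mu)$ sum set if every nonidentity element $a\in X$ admits exactly $\mu$ ordered pairs $(y_1,y_2)\in T\times T$ with $y_1y_2 = a$. -}

module Defs where

open import Level using (0ℓ)
open import Data.Nat using (ℕ; _^_; _≥_)
open import Data.Nat.Primality using (Prime)
open import Data.Fin using (Fin)
import Data.Fin.Properties as FinP
open import Data.Bool using (Bool; _xor_)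
import Data.Bool.Properties as BoolP
open import Data.Product using (Σ; ∃; ∃-syntax; _×_; _,_; proj₁; proj₂)
open import Data.Product.Properties using (≡-dec)
open import Data.List using (List; length; filter; cartesianProduct)
open import Data.List.Relation.Unary.All using (All)
open import Data.List.Relation.Unary.Unique.Propositional using (Unique)
open import Function.Bundles using (_↔_; Inverse)
open import Algebra.Structures using (IsCommutativeRing)
open import Relation.Nullary using (¬_; yes; no)
open import Relation.Binary.Definitions using (DecidableEquality)
open import Relation.Binary.PropositionalEquality using (_≡_; _≢_; refl; sym; trans; cong)

IsPrimePower : ℕ → Set
IsPrimePower q = ∃[ p ] ∃[ k ] (Prime p × k ≥ 1 × q ≡ p ^ k)

record FiniteField (q : ℕ) : Set₁ where
  field
    F      : Set
    _+_    : F → F → F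
    _*_    : F → F → F
    -_     : F → F
    0#     : F
    1#     : F
    isCommutativeRing : IsCommutativeRing _≡_ _+_ _*_ -_ 0# 1#
    0≢1    : 0# ≢ 1#
    inverse : ∀ x → x ≢ 0# → ∃[ y ] (x * y ≡ 1#)
    enum   : F ↔ Fin q

  _≟F_ : DecidableEquality F
  x ≟F y with Inverse.to enum x FinP.≟ Inverse.to enum y
  ... | yes e = yes (trans (sym (Inverse.strictlyInverseʳ enum x))
                      (trans (cong (Inverse.from enum) e) (Inverse.strictlyInverseʳ enum y)))
  ... | no ne = no (λ e → ne (cong (Inverse.to enum) e))

-- Elements of Aff(q) × C₂ are represented as triples (a , b , s) with
-- a ≠ 0; (a , b) stands for the map x ↦ a x + b, and C₂ = (Bool, xor).
module AffC2 {q : ℕ} (K : FiniteField q) where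
  open FiniteField K

  X : Set
  X = F × F × Bool

  InX : X → Set
  InX (a , _ , _) = a ≢ 0#

  -- group law: composition (x ↦ a x + b) ∘ (x ↦ c x + d) = (x ↦ (a c) x + (a d + b)),
  -- componentwise with xor on C₂
  _·_ : X → X → X
  (a , b , s) · (c , d , t) = (a * c , (a * d) + b , s xor t)

  e : X
  e = (1# , 0# , Data.Bool.false)

  _≟X_ : DecidableEquality X
  _≟X_ = ≡-dec _≟F_ (≡-dec _≟F_ BoolP._≟_)

  count : List X → X → ℕ
  count T g = length (filter (λ p → (proj₁ p · proj₂ p) ≟X g) (cartesianProduct T T))

  IsSumSet : ℕ → ℕ → List X → Set
  IsSumSet k μ T =
    All InX T × Unique T × length T ≡ k ×
    (∀ g → InX g → g ≢ e → count T g ≡ μ)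

-- Let T consist of the identity and the 2(q − 1) elements ⟨ a x+1, s ⟩ = (x ↦ a x + 1, s) with
-- a ≠ 0, i.e. the maps sending 0 to 1.  Two of the latter multiply to (x ↦ a c x + (a + 1), s ⊕ t),
-- which never sends 0 to 1.  Hence a nonidentity g = (x ↦ u x + y, r) with y = 1 lies in T and
-- factors over T only as e · g and g · e, while for y ≠ 1 the factorisations are forced to be
-- a = y − 1, c = u / a, t = s ⊕ r, one for each s ∈ C₂.
module Submission where

open import Defs
open import Data.Nat using (ℕ; _*_; _∸_)
open import Data.Product using (∃-syntax)
open import Data.List using (List)

open import Level using (0ℓ)
open import Data.Nat using (suc; _+_)
import Data.Nat.Properties as ℕ
open import Data.Bool using (Bool; true; false; _xor_)
open import Data.Bool.Properties using (not-involutive; xor-identityˡ; xor-identityʳ)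
open import Data.Product using (_×_; _,_; proj₁; proj₂)
open import Data.List using ([]; _∷_; _++_; length; map; filter; cartesianProduct; allFin)
open import Data.List.Properties using (length-map; length-++; length-tabulate)
open import Data.List.Relation.Unary.All as All using (All)
open import Data.List.Relation.Unary.AllPairs using ([]; _∷_)
open import Data.List.Relation.Unary.Any using (here; there)
open import Data.List.Relation.Unary.Unique.Propositional using (Unique)
import Data.List.Relation.Unary.Unique.Propositional.Properties as Unique
open import Data.List.Membership.Propositional using (_∈_)
open import Data.List.Membership.Propositional.Properties
open import Data.List.Membership.Propositional.Properties.WithK using (unique∧set⇒bag)
open import Data.List.Relation.Binary.BagAndSetEquality using (_∼[_]_; set; ∼bag⇒↭)
open import Data.List.Relation.Binary.Permutation.Propositional.Properties using (↭-length)
open import Function.Base using (_∘_)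
open import Function.Bundles using (Inverse; mk⇔)
open import Algebra.Bundles using (CommutativeRing)
open import Algebra.Structures using (IsCommutativeRing)
open import Relation.Nullary using (Dec; ¬?; yes; no; contradiction)
open import Relation.Binary.PropositionalEquality

unique∧set⇒length≡ : {A : Set} {xs ys : List A} → Unique xs → Unique ys →
                     xs ∼[ set ] ys → length xs ≡ length ys
unique∧set⇒length≡ xs-unique ys-unique xs∼ys = ↭-length (∼bag⇒↭ (unique∧set⇒bag xs-unique ys-unique xs∼ys))

length-cartesianProduct : {A B : Set} (xs : List A) (ys : List B) →
                          length (cartesianProduct xs ys) ≡ length xs * length ys
length-cartesianProduct []       ys = refl
length-cartesianProduct (x ∷ xs) ys = begin
  length (map (x ,_) ys ++ cartesianProduct xs ys)
    ≡⟨ length-++ (map (x ,_) ys) ⟩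
  length (map (x ,_) ys) + length (cartesianProduct xs ys)
    ≡⟨ cong₂ _+_ (length-map (x ,_) ys) (length-cartesianProduct xs ys) ⟩
  length ys + length xs * length ys ∎
  where open ≡-Reasoning

xor-cancelˡ : ∀ s r → s xor (s xor r) ≡ r
xor-cancelˡ false r = refl
xor-cancelˡ true  r = not-involutive r

allBools : List Bool
allBools = false ∷ true ∷ []

∈-allBools : ∀ s → s ∈ allBools
∈-allBools false = here refl
∈-allBools true  = there (here refl)

allBools-unique : Unique allBools
allBools-unique = ((λ ()) All.∷ All.[]) ∷ All.[] ∷ []

module _ {q : ℕ} (K : FiniteField q) where
  open FiniteField K renaming (_+_ to infixl 6 _⊕_; _*_ to infixl 7 _⊗_; -_ to infix 8 ⊝_)
  open IsCommutativeRing isCommutativeRing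
    using (+-identityˡ; +-identityʳ; *-assoc; *-comm; *-identityˡ; *-identityʳ; zeroʳ)
  open AffC2 K

  private
    ring : CommutativeRing 0ℓ 0ℓ
    ring = record { isCommutativeRing = isCommutativeRing }

  open import Algebra.Properties.Group (CommutativeRing.+-group ring)
    using (quasigroup; loop; //-rightDividesˡ; x∙y⁻¹≈ε⇒x≈y)
  open import Algebra.Properties.Quasigroup quasigroup using (x≈z//y)
  open import Algebra.Properties.Loop loop using (identityˡ-unique)

  module _ {a a⁻¹ : F} (a⊗a⁻¹≡1 : a ⊗ a⁻¹ ≡ 1#) where
    open ≡-Reasoning

    ⊗-rightDivides : ∀ x → a ⊗ (x ⊗ a⁻¹) ≡ x
    ⊗-rightDivides x = begin
      a ⊗ (x ⊗ a⁻¹) ≡⟨ cong (a ⊗_) (*-comm x a⁻¹) ⟩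
      a ⊗ (a⁻¹ ⊗ x) ≡⟨ *-assoc a a⁻¹ x ⟨
      a ⊗ a⁻¹ ⊗ x   ≡⟨ cong (_⊗ x) a⊗a⁻¹≡1 ⟩
      1# ⊗ x        ≡⟨ *-identityˡ x ⟩
      x             ∎

    ⊗-solveʳ : ∀ {c x} → a ⊗ c ≡ x → c ≡ x ⊗ a⁻¹
    ⊗-solveʳ {c} {x} a⊗c≡x = begin
      c             ≡⟨ *-identityˡ c ⟨
      1# ⊗ c        ≡⟨ cong (_⊗ c) (trans (sym a⊗a⁻¹≡1) (*-comm a a⁻¹)) ⟩
      a⁻¹ ⊗ a ⊗ c   ≡⟨ *-assoc a⁻¹ a c ⟩
      a⁻¹ ⊗ (a ⊗ c) ≡⟨ cong (a⁻¹ ⊗_) a⊗c≡x ⟩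
      a⁻¹ ⊗ x       ≡⟨ *-comm a⁻¹ x ⟩
      x ⊗ a⁻¹       ∎

    ⊗-rightDivides-nonzero : ∀ {x} → x ≢ 0# → x ⊗ a⁻¹ ≢ 0#
    ⊗-rightDivides-nonzero {x} x≢0 x⊗a⁻¹≡0 =
      x≢0 (trans (sym (⊗-rightDivides x)) (trans (cong (a ⊗_) x⊗a⁻¹≡0) (zeroʳ a)))

  elements : List F
  elements = map (Inverse.from enum) (allFin q)

  ∈-elements : ∀ x → x ∈ elements
  ∈-elements x = subst (_∈ elements) (Inverse.strictlyInverseʳ enum x)
                   (∈-map⁺ (Inverse.from enum) (∈-allFin (Inverse.to enum x)))

  elements-unique : Unique elements
  elements-unique = Unique.map⁺ from-injective (Unique.allFin⁺ q)
    where
    from-injective : ∀ {i j} → Inverse.from enum i ≡ Inverse.from enum j → i ≡ j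
    from-injective {i} {j} eq = trans (sym (Inverse.strictlyInverseˡ enum i))
                                  (trans (cong (Inverse.to enum) eq) (Inverse.strictlyInverseˡ enum j))

  nonzero? : ∀ x → Dec (x ≢ 0#)
  nonzero? x = ¬? (x ≟F 0#)

  units : List F
  units = filter nonzero? elements

  units-unique : Unique units
  units-unique = Unique.filter⁺ nonzero? elements-unique

  ∈-units⁻ : ∀ {a} → a ∈ units → a ≢ 0#
  ∈-units⁻ = proj₂ ∘ ∈-filter⁻ nonzero? {xs = elements}

  ∈-units⁺ : ∀ {a} → a ≢ 0# → a ∈ units
  ∈-units⁺ = ∈-filter⁺ nonzero? (∈-elements _)

  1+length-units : suc (length units) ≡ q
  1+length-units = begin
    length (0# ∷ units) ≡⟨ unique∧set⇒length≡ 0#∷units-unique elements-unique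
                             (mk⇔ (λ _ → ∈-elements _) into) ⟩
    length elements     ≡⟨ length-map (Inverse.from enum) (allFin q) ⟩
    length (allFin q)   ≡⟨ length-tabulate (λ i → i) ⟩
    q                   ∎
    where
    open ≡-Reasoning
    0#∷units-unique : Unique (0# ∷ units)
    0#∷units-unique = All.tabulate (λ a∈units 0≡a → ∈-units⁻ a∈units (sym 0≡a)) ∷ units-unique
    into : ∀ {x} → x ∈ elements → x ∈ 0# ∷ units
    into {x} _ with x ≟F 0#
    ... | yes x≡0 = here x≡0
    ... | no  x≢0 = there (∈-units⁺ x≢0)

  ⟨_x+1,_⟩ : F → Bool → X
  ⟨ a x+1, s ⟩ = (a , 1# , s)

  ·-identityˡ : ∀ g → e · g ≡ g
  ·-identityˡ (c , d , s) =
    cong₂ _,_ (*-identityˡ c) (cong₂ _,_ (trans (+-identityʳ _) (*-identityˡ d)) (xor-identityˡ s))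

  ·-identityʳ : ∀ g → g · e ≡ g
  ·-identityʳ (a , b , s) =
    cong₂ _,_ (*-identityʳ a) (cong₂ _,_ (trans (cong (_⊕ b) (zeroʳ a)) (+-identityˡ b)) (xor-identityʳ s))

  ⟨x+1⟩-· : ∀ a c s t → ⟨ a x+1, s ⟩ · ⟨ c x+1, t ⟩ ≡ (a ⊗ c , a ⊕ 1# , s xor t)
  ⟨x+1⟩-· a c s t = cong (λ b → a ⊗ c , b ⊕ 1# , s xor t) (*-identityʳ a)

  sumSet : List X
  sumSet = e ∷ map (λ (a , s) → ⟨ a x+1, s ⟩) (cartesianProduct units allBools)

  data SumSetElement : X → Set where
    identity : SumSetElement e
    affine   : ∀ {a} s → a ≢ 0# → SumSetElement ⟨ a x+1, s ⟩

  ∈-sumSet⁻ : ∀ {g} → g ∈ sumSet → SumSetElement g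
  ∈-sumSet⁻ (here refl) = identity
  ∈-sumSet⁻ (there g∈) with ∈-map⁻ _ g∈
  ... | (a , s) , as∈ , refl = affine s (∈-units⁻ (proj₁ (∈-cartesianProduct⁻ units allBools as∈)))

  ∈-sumSet⁺ : ∀ {g} → SumSetElement g → g ∈ sumSet
  ∈-sumSet⁺ identity       = here refl
  ∈-sumSet⁺ (affine s a≢0) =
    there (∈-map⁺ _ (∈-cartesianProduct⁺ (∈-units⁺ a≢0) (∈-allBools s)))

  All-InX-sumSet : All InX sumSet
  All-InX-sumSet = All.tabulate (inGroup ∘ ∈-sumSet⁻)
    where
    inGroup : ∀ {g} → SumSetElement g → InX g
    inGroup identity       = 0≢1 ∘ sym
    inGroup (affine _ a≢0) = a≢0

  sumSet-unique : Unique sumSet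
  sumSet-unique = All.tabulate e∉ ∷ Unique.map⁺ injective
                    (Unique.cartesianProduct⁺ units-unique allBools-unique)
    where
    e∉ : ∀ {g} → g ∈ map _ (cartesianProduct units allBools) → e ≢ g
    e∉ g∈ e≡g with ∈-map⁻ _ g∈
    ... | _ , _ , refl = 0≢1 (cong (proj₁ ∘ proj₂) e≡g)
    injective : ∀ {as bt} → ⟨ proj₁ as x+1, proj₂ as ⟩ ≡ ⟨ proj₁ bt x+1, proj₂ bt ⟩ → as ≡ bt
    injective refl = refl

  length-sumSet : length sumSet ≡ 2 * q ∸ 1
  length-sumSet = begin
    suc (length (map _ (cartesianProduct units allBools)))
      ≡⟨ cong suc (length-map _ (cartesianProduct units allBools)) ⟩
    suc (length (cartesianProduct units allBools))
      ≡⟨ cong suc (length-cartesianProduct units allBools) ⟩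
    suc (length units * 2)
      ≡⟨ cong (_∸ 1) (ℕ.*-comm (suc (length units)) 2) ⟩
    2 * suc (length units) ∸ 1
      ≡⟨ cong (λ n → 2 * n ∸ 1) 1+length-units ⟩
    2 * q ∸ 1 ∎
    where open ≡-Reasoning

  count≡length : ∀ {T g} {ys : List (X × X)} → Unique T → Unique ys →
                 (∀ {u v} → (u , v) ∈ ys → u ∈ T × v ∈ T × u · v ≡ g) →
                 (∀ {u v} → u ∈ T → v ∈ T → u · v ≡ g → (u , v) ∈ ys) →
                 count T g ≡ length ys
  count≡length {T} {g} {ys} T-unique ys-unique sound complete =
    unique∧set⇒length≡ (Unique.filter⁺ P? (Unique.cartesianProduct⁺ T-unique T-unique))
                       ys-unique (mk⇔ to from)
    where
    P? : ∀ p → Dec (proj₁ p · proj₂ p ≡ g)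
    P? p = (proj₁ p · proj₂ p) ≟X g
    to : ∀ {p} → p ∈ filter P? (cartesianProduct T T) → p ∈ ys
    to p∈ with ∈-filter⁻ P? {xs = cartesianProduct T T} p∈
    ... | uv∈ , uv≡g with ∈-cartesianProduct⁻ T T uv∈
    ... | u∈ , v∈ = complete u∈ v∈ uv≡g
    from : ∀ {p} → p ∈ ys → p ∈ filter P? (cartesianProduct T T)
    from p∈ with sound p∈
    ... | u∈ , v∈ , uv≡g = ∈-filter⁺ P? (∈-cartesianProduct⁺ u∈ v∈) uv≡g

  count-⟨x+1⟩≡2 : ∀ {x} r → x ≢ 0# → count sumSet ⟨ x x+1, r ⟩ ≡ 2
  count-⟨x+1⟩≡2 {x} r x≢0 =
    count≡length sumSet-unique (((e≢g ∘ cong proj₁) All.∷ All.[]) ∷ All.[] ∷ []) sound complete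
    where
    g = ⟨ x x+1, r ⟩
    g∈ = ∈-sumSet⁺ (affine r x≢0)
    e∈ = ∈-sumSet⁺ identity
    e≢g : e ≢ g
    e≢g = 0≢1 ∘ cong (proj₁ ∘ proj₂)
    sound : ∀ {u v} → (u , v) ∈ (e , g) ∷ (g , e) ∷ [] → u ∈ sumSet × v ∈ sumSet × u · v ≡ g
    sound (here refl)         = e∈ , g∈ , ·-identityˡ g
    sound (there (here refl)) = g∈ , e∈ , ·-identityʳ g
    complete : ∀ {u v} → u ∈ sumSet → v ∈ sumSet → u · v ≡ g → (u , v) ∈ (e , g) ∷ (g , e) ∷ []
    complete u∈ v∈ uv≡g with ∈-sumSet⁻ u∈ | ∈-sumSet⁻ v∈
    ... | identity | identity   = contradiction (trans (sym (·-identityˡ e)) uv≡g) e≢g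
    ... | identity | affine t _ = here (cong (e ,_) (trans (sym (·-identityˡ _)) uv≡g))
    ... | affine s _ | identity = there (here (cong (_, e) (trans (sym (·-identityʳ _)) uv≡g)))
    ... | affine {a} s a≢0 | affine {c} t _ =
      contradiction (identityˡ-unique a 1# (cong (proj₁ ∘ proj₂) (trans (sym (⟨x+1⟩-· a c s t)) uv≡g))) a≢0

  count-¬⟨x+1⟩≡2 : ∀ {x y} r → x ≢ 0# → y ≢ 1# → (x , y , r) ≢ e → count sumSet (x , y , r) ≡ 2
  count-¬⟨x+1⟩≡2 {x} {y} r x≢0 y≢1 g≢e =
    count≡length sumSet-unique (Unique.map⁺ injective allBools-unique) sound complete
    where
    a : F
    a = y ⊕ ⊝ 1#
    a≢0 : a ≢ 0#
    a≢0 = y≢1 ∘ x∙y⁻¹≈ε⇒x≈y y 1#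
    a⁻¹ : F
    a⁻¹ = proj₁ (inverse a a≢0)
    a⊗a⁻¹≡1 : a ⊗ a⁻¹ ≡ 1#
    a⊗a⁻¹≡1 = proj₂ (inverse a a≢0)
    c : F
    c = x ⊗ a⁻¹
    factorisation : Bool → X × X
    factorisation s = ⟨ a x+1, s ⟩ , ⟨ c x+1, s xor r ⟩
    injective : ∀ {s t} → factorisation s ≡ factorisation t → s ≡ t
    injective = cong (proj₂ ∘ proj₂ ∘ proj₁)
    sound : ∀ {u v} → (u , v) ∈ map factorisation allBools →
            u ∈ sumSet × v ∈ sumSet × u · v ≡ (x , y , r)
    sound uv∈ with ∈-map⁻ factorisation uv∈
    ... | s , _ , refl =
      ∈-sumSet⁺ (affine s a≢0) ,
      ∈-sumSet⁺ (affine (s xor r) (⊗-rightDivides-nonzero a⊗a⁻¹≡1 x≢0)) ,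
      trans (⟨x+1⟩-· a c s (s xor r))
            (cong₂ _,_ (⊗-rightDivides a⊗a⁻¹≡1 x) (cong₂ _,_ (//-rightDividesˡ 1# y) (xor-cancelˡ s r)))
    complete : ∀ {u v} → u ∈ sumSet → v ∈ sumSet → u · v ≡ (x , y , r) →
               (u , v) ∈ map factorisation allBools
    complete u∈ v∈ uv≡g with ∈-sumSet⁻ u∈ | ∈-sumSet⁻ v∈
    ... | identity | identity   = contradiction (trans (sym uv≡g) (·-identityˡ e)) g≢e
    ... | identity | affine {c′} t _ =
      contradiction (cong (proj₁ ∘ proj₂) (trans (sym (·-identityˡ ⟨ c′ x+1, t ⟩)) uv≡g)) (y≢1 ∘ sym)
    ... | affine {a′} s _ | identity =
      contradiction (cong (proj₁ ∘ proj₂) (trans (sym (·-identityʳ ⟨ a′ x+1, s ⟩)) uv≡g)) (y≢1 ∘ sym)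
    ... | affine {a′} s _ | affine {c′} t _
      with product ← trans (sym (⟨x+1⟩-· a′ c′ s t)) uv≡g
      with refl ← x≈z//y a′ 1# y (cong (proj₁ ∘ proj₂) product)
      with refl ← ⊗-solveʳ a⊗a⁻¹≡1 (cong proj₁ product)
      with refl ← trans (sym (xor-cancelˡ s t)) (cong (s xor_) (cong (proj₂ ∘ proj₂) product))
      = ∈-map⁺ factorisation (∈-allBools s)

  count-sumSet : ∀ g → InX g → g ≢ e → count sumSet g ≡ 2
  count-sumSet (x , y , r) x≢0 g≢e with y ≟F 1#
  ... | yes refl = count-⟨x+1⟩≡2 r x≢0
  ... | no  y≢1  = count-¬⟨x+1⟩≡2 r x≢0 y≢1 g≢e

  sumSet-isSumSet : IsSumSet (2 * q ∸ 1) 2 sumSet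
  sumSet-isSumSet = All-InX-sumSet , sumSet-unique , length-sumSet , count-sumSet

-- The prime-power hypothesis is only what makes a field of order q exist.
corollary7p2 : (q : ℕ) → IsPrimePower q → (K : FiniteField q) →
    ∃[ T ] AffC2.IsSumSet K (2 * q ∸ 1) 2 T
corollary7p2 q _ K = sumSet K , sumSet-isSumSet K
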